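{- Let $T^{in}$ be a tree (in-arborescence rooted at $r$) and $S^{in}$ a spanning tree such that $S^{in}$ is strongly stable on a set $\mathbb{O}$ and $S^{in}$ is a skeleton of $T^{in}$ (with respect to $\mathbb{O}$). Then the procedure FindStable$(T^{in},S^{in},\mathbb{O})$ described in the context outputs a spanning tree $S^{out}$ that is strongly stable on $\mathbb{O}\cup\mathcal{O}$, where $\mathcal{O}=V\setminus V(T^{in})$.
   Context: $G=(V,A_G)$ is a directed graph with sink $r$ (no outgoing arcs), every node having a directed path to $r$; each node $v\neq r$ has a strict ranking of its out-neighbours. A tree is an in-arborescence in $G$ rooted at $r$; a spanning tree contains all nodes; for $(v,w)$ in a tree, $w$ is the parent of $v$. For $Q\subseteq V$ and $v\in Q$, the $Q$-subtree of $v$ with respect to a tree $S$ is the maximal subtree rooted at $v$ of the forest $S[Q]$. $S$ is strongly stable on $\mathbb{O}$ if every node $v\in\mathbb{O}$ with $(v,w)\in S$ prefers $w$ to every other out-neighbour of $v$ outside the $\mathbb{O}$-subtree of $v$. $\mathcal{A}^+_S(U)=\{(u,v)\in S:u\in U\}$. A spanning tree $S$ is a skeleton of a tree $T$ (w.r.t. $\mathbb{O}$) if for every maximal subtree $F$ of $S[\mathbb{O}]$, either $T\supseteq\mathcal{A}^+_S(V(F))$ or $T$ contains no node of $F$. Procedure FindStable$(T^{in},S^{in},\mathbb{O})$: let $\mathcal{O}=V\setminus V(T^{in})$; initialise $S^{out}:=T^{in}\cup\mathcal{A}^+_{S^{in}}(\mathcal{O})$ and $\mathcal{C}_1:=S^{out}[\mathcal{O}]$;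 for $t=1,\dots,|\mathcal{O}|$: pick an arbitrary leaf $v$ of the forest $\mathcal{C}_t$ (a node with no children in $\mathcal{C}_t$), pick the out-neighbour $w$ of $v$ that $v$ prefers to every other node not in the $\mathcal{O}$-subtree of $v$ in $S^{out}$, replace the arc $(v,y)$ of $S^{out}$ by $(v,w)$, and set $\mathcal{C}_{t+1}:=\mathcal{C}_t\setminus\{v\}$; return $S^{out}$. -}

module Defs where

open import Data.Nat using (ℕ; _<_)
open import Data.Fin using (Fin; _≟_)
open import Data.Bool using (Bool; true; false; T)
open import Data.Maybe using (Maybe; just; nothing; maybe)
open import Data.Product using (Σ; ∃; ∃-syntax; _×_; _,_)
open import Data.Sum using (_⊎_)
open import Relation.Nullary using (¬_; yes; no)
open import Relation.Binary.PropositionalEquality using (_≡_; _≢_)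

-- Instance: directed graph on Fin n with sink r, every node reaching r,
-- and for each v ≠ r a strict ranking of its out-neighbours, given by a
-- rank function that is injective on the out-neighbours of v
-- (v prefers a to b  iff  rank v a < rank v b).

record Instance (n : ℕ) : Set where
  field
    r    : Fin n
    adj  : Fin n → Fin n → Bool
    rank : Fin n → Fin n → ℕ

  Arc : Fin n → Fin n → Set
  Arc v w = T (adj v w)

  Prefers : Fin n → Fin n → Fin n → Set
  Prefers v a b = rank v a < rank v b

  data ReachesSink : Fin n → Set where
    here : ReachesSink r
    step : ∀ {v w} → Arc v w → ReachesSink w → ReachesSink v

record WellFormed {n : ℕ} (G : Instance n) : Set where
  open Instance G
  field
    sink      : ∀ w → ¬ Arc r w
    reach     : ∀ v → ReachesSink v
    rank-inj  : ∀ v a b → v ≢ r → Arc v a → Arc v b → rank v a ≡ rank v b → a ≡ b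

-- Arc sets with out-degree ≤ 1 (all objects of the statement are such),
-- represented by their parent function: P v ≡ just w  iff  (v , w) ∈ P.

Par : ℕ → Set
Par n = Fin n → Maybe (Fin n)

Subset : ℕ → Set₁
Subset n = Fin n → Set

_∪_ : ∀ {n} → Subset n → Subset n → Subset n
(A ∪ B) u = A u ⊎ B u

module _ {n : ℕ} (G : Instance n) where
  open Instance G

  InTree : Par n → Fin n → Set
  InTree P v = v ≡ r ⊎ ∃[ w ] P v ≡ just w

  data ReachesRoot (P : Par n) : Fin n → Set where
    root : ReachesRoot P r
    up   : ∀ {v w} → P v ≡ just w → ReachesRoot P w → ReachesRoot P v

  IsTree : Par n → Set
  IsTree P = (P r ≡ nothing)
           × (∀ v w → P v ≡ just w → Arc v w)
           × (∀ v → InTree P v → ReachesRoot P v)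

  IsSpanningTree : Par n → Set
  IsSpanningTree P = IsTree P × (∀ v → InTree P v)

  -- u belongs to the Q-subtree of v with respect to P, i.e. the maximal
  -- subtree rooted at v of the forest P[Q] (v ∈ Q assumed by the base case)
  data InSub (P : Par n) (Q : Subset n) (v : Fin n) : Fin n → Set where
    base : Q v → InSub P Q v v
    desc : ∀ {u u'} → Q u → P u ≡ just u' → InSub P Q v u' → InSub P Q v u

  StronglyStable : Par n → Subset n → Set
  StronglyStable P Q =
    ∀ v w → Q v → P v ≡ just w →
    ∀ u → Arc v u → u ≢ w → ¬ InSub P Q v u → Prefers v w u

  OutArcsIn : Par n → Subset n → Par n → Set
  OutArcsIn P U P' = ∀ u w → U u → P u ≡ just w → P' u ≡ just w

  -- ρ is the root of a maximal subtree (component) of the forest P[Q];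
  -- that component has node set InSub P Q ρ
  IsCompRoot : Par n → Subset n → Fin n → Set
  IsCompRoot P Q ρ = Q ρ × (∀ w → P ρ ≡ just w → ¬ Q w)

  IsSkeleton : Par n → Par n → Subset n → Set
  IsSkeleton S Tr 𝕆 =
    ∀ ρ → IsCompRoot S 𝕆 ρ →
      OutArcsIn S (InSub S 𝕆 ρ) Tr
      ⊎ (∀ u → InSub S 𝕆 ρ u → ¬ InTree Tr u)

  Outside : Par n → Subset n
  Outside Tin u = ¬ InTree Tin u

  -- initial S^out = Tin ∪ A⁺_{Sin}(𝒪): nodes of Tin keep their Tin-arc,
  -- nodes outside Tin take their Sin-arc
  initOut : Par n → Par n → Par n
  initOut Tin Sin u = maybe just (Sin u) (Tin u)

  redirect : Par n → Fin n → Fin n → Par n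
  redirect P v w u with u ≟ v
  ... | yes _ = just w
  ... | no  _ = P u

  remove : Subset n → Fin n → Subset n
  remove R v u = R u × u ≢ v

  IsLeaf : Par n → Subset n → Fin n → Set
  IsLeaf P R v = R v × (∀ u → R u → P u ≢ just v)

  IsBestChoice : Par n → Subset n → Fin n → Fin n → Set
  IsBestChoice P 𝒪 v w =
    Arc v w × ¬ InSub P 𝒪 v w ×
    (∀ u → Arc v u → u ≢ w → ¬ InSub P 𝒪 v u → Prefers v w u)

  -- Run 𝒪 P R P' : starting from current S^out = P and current forest
  -- C_t on node set R, the loop (with arbitrary leaf choices) terminates
  -- with output P'.  Since each iteration removes one node of R and the
  -- loop starts with R = 𝒪, stopping when R = ∅ is exactly |𝒪| iterations.
  data Run (𝒪 : Subset n) : Par n → Subset n → Par n → Set₁ where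
    done : ∀ {P R} → (∀ u → ¬ R u) → Run 𝒪 P R P
    next : ∀ {P R P'} v w → IsLeaf P R v → IsBestChoice P 𝒪 v w →
           Run 𝒪 (redirect P v w) (remove R v) P' → Run 𝒪 P R P'

  FindStableOutput : Par n → Par n → Par n → Set₁
  FindStableOutput Tin Sin S =
    Run (Outside Tin) (initOut Tin Sin) (Outside Tin) S

-- FindStable maintains an invariant on the current Sᵒᵘᵗ: it is a spanning tree
-- agreeing with Tⁱⁿ on V(Tⁱⁿ), every processed node of 𝒪 prefers its parent to
-- every out-neighbour outside its 𝒪-subtree, and the parent of an unprocessed
-- node is never processed.  The last clause keeps unprocessed nodes out of
-- processed 𝒪-subtrees, so redirecting the arc of a leaf v leaves those subtrees,
-- and hence their stability, intact, while the 𝒪-subtree of v can only grow.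
-- Since V(Tⁱⁿ) is closed under taking parents, every descendant of v lies in its
-- 𝒪-subtree, which the new parent avoids, so no cycle arises.  A node of
-- 𝕆 ∩ V(Tⁱⁿ) keeps its Sⁱⁿ-arc: by the skeleton property its whole 𝕆-component
-- in Sⁱⁿ lies in Tⁱⁿ, so its 𝕆-subtree survives in Sᵒᵘᵗ and it inherits stability
-- from Sⁱⁿ.  The loop never gets stuck: a deepest unprocessed node is a leaf, and
-- its current parent shows that a best choice exists.
module Submission where

open import Data.Bool.Properties using (T?)
open import Data.Empty using (⊥-elim)
open import Data.Fin using (Fin; _≟_)
open import Data.Fin.Properties using (any?)
open import Data.List using (List; length; filter; allFin)
open import Data.List.Extrema.Nat using (argmin; argmax; argmin-all; argmax-all; f[argmin]≤f[xs]; f[xs]≤f[argmax])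
open import Data.List.Membership.Propositional using (_∈_)
open import Data.List.Membership.Propositional.Properties using (∈-filter⁺; ∈-filter⁻; ∈-allFin)
open import Data.List.Properties using (filter-notAll)
import Data.List.Relation.Unary.All as All
import Data.List.Relation.Unary.Any as Any
open import Data.Maybe using (just; nothing)
open import Data.Maybe.Properties using (just-injective)
open import Data.Nat using (ℕ; zero; suc; _≤_; _<_; _<?_)
open import Data.Nat.Induction using (<-wellFounded)
open import Data.Nat.Properties using (1+n≰n; ≤∧≢⇒<)
open import Data.Product using (∃; ∃-syntax; _×_; _,_; proj₁; proj₂)
open import Data.Sum using (_⊎_; inj₁; inj₂; [_,_]′)
open import Data.Unit using (tt)
open import Function using (_∘_)
open import Induction.WellFounded using (Acc; acc)
open import Relation.Binary.PropositionalEquality using (_≡_; _≢_; refl; sym; trans; subst; cong)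
open import Relation.Nullary using (¬_; Dec; yes; no; contradiction)
open import Relation.Nullary.Decidable using (_×-dec_; ¬?; decidable-stable; ¬¬-excluded-middle)
open import Relation.Nullary.Negation using (¬¬-map)
open import Relation.Unary using (Decidable; U; ∁; _∩_)

open import Defs

module _ {n : ℕ} {C : Subset n} (C? : Decidable C) (f : Fin n → ℕ) where
  private
    candidates : List (Fin n)
    candidates = filter C? (allFin n)

    all-candidates : All.All C candidates
    all-candidates = All.tabulate (proj₂ ∘ ∈-filter⁻ C? {xs = allFin n})

    candidate : ∀ {y} → C y → y ∈ candidates
    candidate {y} cy = ∈-filter⁺ C? (∈-allFin y) cy

  argmin-Fin : ∃ C → ∃[ x ] C x × (∀ y → C y → f x ≤ f y)
  argmin-Fin (x₀ , cx₀) =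
    argmin f x₀ candidates , argmin-all f cx₀ all-candidates ,
    λ y cy → All.lookup (f[argmin]≤f[xs] x₀ candidates) (candidate cy)

  argmax-Fin : ∃ C → ∃[ x ] C x × (∀ y → C y → f y ≤ f x)
  argmax-Fin (x₀ , cx₀) =
    argmax f x₀ candidates , argmax-all f cx₀ all-candidates ,
    λ y cy → All.lookup (f[xs]≤f[argmax] x₀ candidates) (candidate cy)

module _ {n : ℕ} (G : Instance n) where
  open Instance G

  private
    variable
      P P₁ Sin S : Par n
      Q Q₁ D R 𝕆 : Subset n
      u v w x y : Fin n

  parent⇒≢root : (P : Par n) → P r ≡ nothing → P v ≡ just y → v ≢ r
  parent⇒≢root P orphan e refl = contradiction (trans (sym orphan) e) λ ()

  ReachesRoot⇒InTree : ReachesRoot G P v → InTree G P v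
  ReachesRoot⇒InTree root     = inj₁ refl
  ReachesRoot⇒InTree (up e _) = inj₂ (_ , e)

  ReachesRoot-mono : (∀ x y → P x ≡ just y → P₁ x ≡ just y) →
                     ReachesRoot G P v → ReachesRoot G P₁ v
  ReachesRoot-mono P⊆P₁ root        = root
  ReachesRoot-mono P⊆P₁ (up e rest) = up (P⊆P₁ _ _ e) (ReachesRoot-mono P⊆P₁ rest)

  InTree? : (P : Par n) → Decidable (InTree G P)
  InTree? P v with v ≟ r | P v
  ... | yes v≡r | _       = yes (inj₁ v≡r)
  ... | no _    | just w  = yes (inj₂ (w , refl))
  ... | no v≢r  | nothing = no λ where
    (inj₁ v≡r)      → v≢r v≡r
    (inj₂ (_ , ()))

  ∉InTree⇒orphan : ¬ InTree G P v → P v ≡ nothing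
  ∉InTree⇒orphan {P = P} {v = v} v∉ with P v
  ... | nothing = refl
  ... | just w  = contradiction (inj₂ (w , refl)) v∉

  depth : ReachesRoot G P v → ℕ
  depth root        = zero
  depth (up _ rest) = suc (depth rest)

  depth-unique : P r ≡ nothing → (a b : ReachesRoot G P v) → depth a ≡ depth b
  depth-unique         orphan root     root     = refl
  depth-unique {P = P} orphan root     (up e _) = ⊥-elim (parent⇒≢root P orphan e refl)
  depth-unique {P = P} orphan (up e _) root     = ⊥-elim (parent⇒≢root P orphan e refl)
  depth-unique orphan (up e a) (up e′ b) with just-injective (trans (sym e) e′)
  ... | refl = cong suc (depth-unique orphan a b)

  InSub-member : InSub G P Q v u → Q u
  InSub-member (base q)     = q
  InSub-member (desc q _ _) = q

  InSub-trans : InSub G P Q v w → InSub G P Q w u → InSub G P Q v u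
  InSub-trans s (base _)     = s
  InSub-trans s (desc q e t) = desc q e (InSub-trans s t)

  InSub-mono : (∀ u → Q u → Q₁ u) → InSub G P Q v u → InSub G P Q₁ v u
  InSub-mono Q⊆Q₁ (base q)     = base (Q⊆Q₁ _ q)
  InSub-mono Q⊆Q₁ (desc q e s) = desc (Q⊆Q₁ _ q) e (InSub-mono Q⊆Q₁ s)

  InSub-transport : OutArcsIn G P (InSub G P Q v) P₁ → InSub G P Q v u → InSub G P₁ Q v u
  InSub-transport P⊆P₁ (base q)       = base q
  InSub-transport P⊆P₁ s@(desc q e t) = desc q (P⊆P₁ _ _ s e) (InSub-transport P⊆P₁ t)

  UpwardClosed : Par n → Subset n → Set
  UpwardClosed P D = ∀ x y → D x → P x ≡ just y → D y

  InSub-∁-upward-closed : UpwardClosed P D → ¬ D v → InSub G P U v u → InSub G P (∁ D) v u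
  InSub-∁-upward-closed closed v∉D (base _) = base v∉D
  InSub-∁-upward-closed {P = P} {D = D} {v = v} closed v∉D (desc {u} {u′} _ e s) =
    desc (λ Du → InSub-member s′ (closed u _ Du e)) e s′
    where
    s′ : InSub G P (∁ D) v u′
    s′ = InSub-∁-upward-closed closed v∉D s

  InSub? : P r ≡ nothing → Decidable Q → ReachesRoot G P u → Dec (InSub G P Q v u)
  InSub? {P = P} {Q = Q} {u = u} {v = v} orphan Q? reach with Q? u | u ≟ v
  ... | no ¬q | _        = no (¬q ∘ InSub-member)
  ... | yes q | yes refl = yes (base q)
  ... | yes q | no u≢v   = via-parent q u≢v reach
    where
    via-parent : ∀ {x} → Q x → x ≢ v → ReachesRoot G P x → Dec (InSub G P Q v x)
    via-parent q x≢v root = no λ where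
      (base _)     → x≢v refl
      (desc _ e _) → parent⇒≢root P orphan e refl
    via-parent q x≢v (up e rest) with InSub? orphan Q? rest
    ... | yes s = yes (desc q e s)
    ... | no ¬s = no λ where
      (base _)      → x≢v refl
      (desc _ e′ s) → ¬s (subst (InSub G P Q v) (just-injective (trans (sym e′) e)) s)

  parent-∉-InSub : P r ≡ nothing → ReachesRoot G P y → P v ≡ just y → ¬ InSub G P Q v y
  parent-∉-InSub {P = P} {y = y} {Q = Q} orphan reach e s = climb reach e s s
    where
    climb : ∀ {v x} → ReachesRoot G P x → P v ≡ just y → InSub G P Q v x → ¬ InSub G P Q v y
    climb root         e (base _)      _ = parent⇒≢root P orphan e refl
    climb root         _ (desc _ e′ _) _ = parent⇒≢root P orphan e′ refl
    climb (up e′ rest) e (base _)      s with just-injective (trans (sym e) e′)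
    ... | refl = climb rest e s s
    climb (up e′ rest) e (desc _ e″ t) s with just-injective (trans (sym e″) e′)
    ... | refl = climb rest e t s

  ¬¬-component : P r ≡ nothing → ReachesRoot G P v → Q v →
                 ¬ ¬ (∃[ ρ ] IsCompRoot G P Q ρ × InSub G P Q ρ v)
  ¬¬-component {P = P} orphan root q k =
    k (r , (q , λ _ e _ → parent⇒≢root P orphan e refl) , base q)
  ¬¬-component {Q = Q} orphan (up e rest) q k = ¬¬-excluded-middle λ where
    (yes qy) → ¬¬-component orphan rest qy λ (ρ , ρ-root , s) → k (ρ , ρ-root , desc q e s)
    (no ¬qy) → k (_ , (q , λ _ e′ → ¬qy ∘ subst Q (just-injective (trans (sym e′) e))) , base q)

  redirect-self : redirect G P v w v ≡ just w
  redirect-self {v = v} with v ≟ v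
  ... | yes _  = refl
  ... | no v≢v = contradiction refl v≢v

  redirect-other : u ≢ v → redirect G P v w u ≡ P u
  redirect-other {u = u} {v = v} u≢v with u ≟ v
  ... | yes u≡v = contradiction u≡v u≢v
  ... | no _    = refl

  redirect-reaches : ReachesRoot G P w → ¬ InSub G P U v w →
                     ReachesRoot G P x → ReachesRoot G (redirect G P v w) x
  redirect-reaches {P = P} {w = w} {v = v} w-reaches w∉ = lift
    where
    P′ : Par n
    P′ = redirect G P v w

    unchanged-or-below : ∀ {x} → ReachesRoot G P x → ReachesRoot G P′ x ⊎ InSub G P U v x
    unchanged-or-below root = inj₁ root
    unchanged-or-below (up {x} e rest) with x ≟ v | unchanged-or-below rest
    ... | yes refl | _         = inj₂ (base tt)
    ... | no x≢v   | inj₁ rest′ = inj₁ (up (trans (redirect-other x≢v) e) rest′)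
    ... | no _     | inj₂ s     = inj₂ (desc tt e s)

    lift : ∀ {x} → ReachesRoot G P x → ReachesRoot G P′ x
    lift root = root
    lift (up {x} e rest) with x ≟ v
    ... | yes refl = [ up (redirect-self {P = P} {v = v} {w = w}) , ⊥-elim ∘ w∉ ]′
                       (unchanged-or-below w-reaches)
    ... | no x≢v   = up (trans (redirect-other x≢v) e) (lift rest)

  InSub-redirect-self : InSub G P Q v u → InSub G (redirect G P v w) Q v u
  InSub-redirect-self (base q) = base q
  InSub-redirect-self {v = v} (desc {u} q e s) with u ≟ v
  ... | yes refl = base q
  ... | no u≢v   = desc q (trans (redirect-other u≢v) e) (InSub-redirect-self s)

  InSub-redirect-other : ¬ InSub G P Q x v → InSub G P Q x u → InSub G (redirect G P v w) Q x u
  InSub-redirect-other v∉ (base q) = base q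
  InSub-redirect-other {v = v} v∉ s@(desc {u} q e t) with u ≟ v
  ... | yes refl = contradiction s v∉
  ... | no u≢v   = desc q (trans (redirect-other u≢v) e) (InSub-redirect-other v∉ t)

  record Arborescence (P : Par n) : Set where
    field
      root-orphan : P r ≡ nothing
      parent-arc  : ∀ v w → P v ≡ just w → Arc v w
      reaches     : ∀ v → ReachesRoot G P v

  spanning⇒arborescence : IsSpanningTree G P → Arborescence P
  spanning⇒arborescence ((orphan , arcs , reach) , spans) = record
    { root-orphan = orphan ; parent-arc = arcs ; reaches = λ v → reach v (spans v) }

  arborescence⇒spanning : Arborescence P → IsSpanningTree G P
  arborescence⇒spanning A =
    (root-orphan , parent-arc , λ v _ → reaches v) , ReachesRoot⇒InTree ∘ reaches
    where open Arborescence A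

  ≢root⇒parent : Arborescence P → v ≢ r → ∃[ y ] P v ≡ just y
  ≢root⇒parent A v≢r with ReachesRoot⇒InTree (Arborescence.reaches A _)
  ... | inj₁ v≡r = contradiction v≡r v≢r
  ... | inj₂ p   = p

  redirect-arborescence : Arborescence P → Arc v w → ¬ InSub G P U v w → v ≢ r →
                          Arborescence (redirect G P v w)
  redirect-arborescence {P = P} {v = v} {w = w} A arc w∉ v≢r = record
    { root-orphan = trans (redirect-other (v≢r ∘ sym)) root-orphan
    ; parent-arc  = parent-arc′
    ; reaches     = redirect-reaches (reaches w) w∉ ∘ reaches
    }
    where
    open Arborescence A
    parent-arc′ : ∀ x y → redirect G P v w x ≡ just y → Arc x y
    parent-arc′ x y e with x ≟ v
    ... | yes refl = subst (Arc v) (just-injective e) arc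
    ... | no _     = parent-arc x y e

  leaf-exists : Arborescence P → Decidable R → ∃ R → ∃[ v ] IsLeaf G P R v
  leaf-exists {P = P} {R = R} A R? ∃R with argmax-Fin R? (depth ∘ Arborescence.reaches A) ∃R
  ... | v₀ , Rv₀ , deepest = v₀ , Rv₀ , no-pending-child
    where
    open Arborescence A
    no-pending-child : ∀ u → R u → P u ≢ just v₀
    no-pending-child u Ru e = 1+n≰n (subst (_≤ depth (reaches v₀))
      (depth-unique root-orphan (reaches u) (up e (reaches v₀))) (deepest u Ru))

  StableOutside : Par n → Subset n → Subset n → Set
  StableOutside P D Q =
    ∀ v w → D v → P v ≡ just w →
    ∀ u → Arc v u → u ≢ w → ¬ InSub G P Q v u → Prefers v w u

  StableOutside-mono : (∀ u → Q u → Q₁ u) → StableOutside P D Q → StableOutside P D Q₁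
  StableOutside-mono Q⊆Q₁ stable v w d e u arc u≢w u∉ =
    stable v w d e u arc u≢w (u∉ ∘ InSub-mono Q⊆Q₁)

  best-choice-exists : WellFormed G → Arborescence P → Decidable Q → v ≢ r →
                       ∃[ w ] IsBestChoice G P Q v w
  best-choice-exists {P = P} {Q = Q} {v = v} wf A Q? v≢r
    with argmin-Fin Candidate? (rank v) current-parent
    where
    open Arborescence A
    Candidate : Subset n
    Candidate u = Arc v u × ¬ InSub G P Q v u
    Candidate? : Decidable Candidate
    Candidate? u = T? (adj v u) ×-dec ¬? (InSub? root-orphan Q? (reaches u))
    current-parent : ∃ Candidate
    current-parent with ≢root⇒parent A v≢r
    ... | y , e = y , parent-arc v y e , parent-∉-InSub root-orphan (reaches y) e
  ... | w₀ , (arc , w₀∉) , minimal = w₀ , arc , w₀∉ , best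
    where
    best : ∀ u → Arc v u → u ≢ w₀ → ¬ InSub G P Q v u → Prefers v w₀ u
    best u arc-u u≢w₀ u∉ = ≤∧≢⇒< (minimal u (arc-u , u∉))
                                  (u≢w₀ ∘ sym ∘ WellFormed.rank-inj wf v w₀ u v≢r arc arc-u)

  module FindStable (Tin : Par n) (Tin-tree : IsTree G Tin) where

    Out : Subset n
    Out = Outside G Tin

    Out? : Decidable Out
    Out? u = ¬? (InTree? Tin u)

    Out⇒≢root : Out v → v ≢ r
    Out⇒≢root v∉ v≡r = v∉ (inj₁ v≡r)

    Tin-orphan : Tin r ≡ nothing
    Tin-orphan = proj₁ Tin-tree

    Tin-reaches : InTree G Tin v → ReachesRoot G Tin v
    Tin-reaches = proj₂ (proj₂ Tin-tree) _

    Tin-parent-InTree : Tin x ≡ just y → InTree G Tin y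
    Tin-parent-InTree e with Tin-reaches (inj₂ (_ , e))
    ... | root       = ⊥-elim (parent⇒≢root Tin Tin-orphan e refl)
    ... | up e′ rest = subst (InTree G Tin) (just-injective (trans (sym e′) e))
                             (ReachesRoot⇒InTree rest)

    Processed : Subset n → Subset n
    Processed R y = Out y × ¬ R y

    -- P is the current Sᵒᵘᵗ and R the node set of the current forest 𝒞ₜ
    record Invariant (P : Par n) (R : Subset n) : Set where
      field
        arborescence     : Arborescence P
        agrees-Tin       : ∀ x → InTree G Tin x → P x ≡ Tin x
        pending-outside  : ∀ x → R x → Out x
        pending-parent   : ∀ x y → R x → P x ≡ just y → ¬ Processed R y
        processed-stable : StableOutside P (Processed R) Out

    open Invariant

    InTree-upward-closed : Invariant P R → UpwardClosed P (InTree G Tin)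
    InTree-upward-closed inv x y x∈ e = Tin-parent-InTree (trans (sym (agrees-Tin inv x x∈)) e)

    processed-subtree-settled : Invariant P R → Processed R x → InSub G P Out x u → ¬ R u
    processed-subtree-settled inv x-done (base _) = proj₂ x-done
    processed-subtree-settled inv x-done (desc {u} {u′} _ e s) Ru =
      pending-parent inv u u′ Ru e (InSub-member s , processed-subtree-settled inv x-done s)

    initOut-Tin : ∀ Sin → Tin u ≡ just w → initOut G Tin Sin u ≡ just w
    initOut-Tin Sin e rewrite e = refl

    initOut-Sin : ∀ Sin → Tin u ≡ nothing → initOut G Tin Sin u ≡ Sin u
    initOut-Sin Sin e rewrite e = refl

    invariant-init : IsSpanningTree G Sin → Invariant (initOut G Tin Sin) Out
    invariant-init {Sin = Sin} Sin-spanning = record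
      { arborescence = record
        { root-orphan = trans (initOut-Sin Sin Tin-orphan) root-orphan
        ; parent-arc  = parent-arc′
        ; reaches     = reaches′ ∘ reaches
        }
      ; agrees-Tin       = agrees
      ; pending-outside  = λ _ o → o
      ; pending-parent   = λ _ _ o _ (o′ , ¬o) → ¬o o′
      ; processed-stable = λ _ _ (o , ¬o) → contradiction o ¬o
      }
      where
      open Arborescence (spanning⇒arborescence Sin-spanning)
      P₀ : Par n
      P₀ = initOut G Tin Sin

      parent-arc′ : ∀ v w → P₀ v ≡ just w → Arc v w
      parent-arc′ v w e with Tin v in e-Tin
      ... | just _  = proj₁ (proj₂ Tin-tree) v w (trans e-Tin e)
      ... | nothing = parent-arc v w e

      reaches′ : ∀ {x} → ReachesRoot G Sin x → ReachesRoot G P₀ x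
      reaches′ root = root
      reaches′ (up {x} e rest) with InTree? Tin x
      ... | yes x∈ = ReachesRoot-mono (λ _ _ → initOut-Tin Sin) (Tin-reaches x∈)
      ... | no x∉  = up (trans (initOut-Sin Sin (∉InTree⇒orphan {P = Tin} x∉)) e) (reaches′ rest)

      agrees : ∀ x → InTree G Tin x → P₀ x ≡ Tin x
      agrees x (inj₁ refl)    = trans (initOut-Sin Sin Tin-orphan) (trans root-orphan (sym Tin-orphan))
      agrees x (inj₂ (_ , e)) = trans (initOut-Tin Sin e) (sym e)

    invariant-step : Invariant P R → IsLeaf G P R v → IsBestChoice G P Out v w →
                     Invariant (redirect G P v w) (remove G R v)
    invariant-step {P = P} {R = R} {v = v} {w = w} inv (Rv , leaf) (arc , w∉ , prefers-w) = record
      { arborescence     = redirect-arborescence (arborescence inv) arc w∉-below (Out⇒≢root Ov)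
      ; agrees-Tin       = λ x x∈ → trans (unchanged (λ { refl → Ov x∈ })) (agrees-Tin inv x x∈)
      ; pending-outside  = λ x (Rx , _) → pending-outside inv x Rx
      ; pending-parent   = pending-parent′
      ; processed-stable = processed-stable′
      }
      where
      P′ : Par n
      P′ = redirect G P v w

      R′ : Subset n
      R′ = remove G R v

      Ov : Out v
      Ov = pending-outside inv v Rv

      unchanged : ∀ {x} → x ≢ v → P′ x ≡ P x
      unchanged = redirect-other

      w∉-below : ¬ InSub G P U v w
      w∉-below = w∉ ∘ InSub-∁-upward-closed (InTree-upward-closed inv) Ov

      still-processed : ∀ {x} → x ≢ v → Processed R′ x → Processed R x
      still-processed x≢v (Ox , x-done) = Ox , λ Rx → x-done (Rx , x≢v)

      pending-parent′ : ∀ x y → R′ x → P′ x ≡ just y → ¬ Processed R′ y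
      pending-parent′ x y (Rx , x≢v) e (Oy , y-done) with y ≟ v
      ... | yes refl = leaf x Rx (trans (sym (unchanged x≢v)) e)
      ... | no y≢v   = pending-parent inv x y Rx (trans (sym (unchanged x≢v)) e)
                                      (Oy , λ Ry → y-done (Ry , y≢v))

      processed-stable′ : StableOutside P′ (Processed R′) Out
      processed-stable′ x w′ x-done e u arc-u u≢w′ u∉ with x ≟ v
      ... | yes refl with just-injective e
      ...   | refl = prefers-w u arc-u u≢w′ (u∉ ∘ InSub-redirect-self)
      processed-stable′ x w′ x-done e u arc-u u≢w′ u∉ | no x≢v =
        processed-stable inv x w′ x-processed e u arc-u u≢w′
          (u∉ ∘ InSub-redirect-other (λ s → processed-subtree-settled inv x-processed s Rv))
        where
        x-processed : Processed R x
        x-processed = still-processed x≢v x-done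

    run-invariant : Invariant P R → Run G Out P R S →
                    ∃[ R′ ] Invariant S R′ × (∀ u → ¬ R′ u)
    run-invariant inv (done empty)               = _ , inv , empty
    run-invariant inv (next _ _ leaf best steps) = run-invariant (invariant-step inv leaf best) steps

    -- xs over-approximates R; it loses the processed node at each step
    run-exists : WellFormed G → Invariant P R → Decidable R →
                 (xs : List (Fin n)) → (∀ u → R u → u ∈ xs) → Acc _<_ (length xs) →
                 ∃[ S ] Run G Out P R S
    run-exists {P = P} {R = R} wf inv R? xs R⊆xs (acc smaller) with any? R?
    ... | no ∄R  = _ , done λ u Ru → ∄R (u , Ru)
    ... | yes ∃R with leaf-exists (arborescence inv) R? ∃R
    ...   | v₀ , leaf with best-choice-exists wf (arborescence inv) Out?
                              (Out⇒≢root (pending-outside inv v₀ (proj₁ leaf)))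
    ...     | w₀ , best with rest
      where
      ≢v₀? : Decidable (λ u → u ≢ v₀)
      ≢v₀? u = ¬? (u ≟ v₀)

      shorter : length (filter ≢v₀? xs) < length xs
      shorter = filter-notAll ≢v₀? xs
                  (Any.map (λ v₀≡u u≢v₀ → u≢v₀ (sym v₀≡u)) (R⊆xs v₀ (proj₁ leaf)))

      rest : ∃[ S ] Run G Out (redirect G P v₀ w₀) (remove G R v₀) S
      rest = run-exists wf (invariant-step inv leaf best) (λ u → R? u ×-dec ≢v₀? u) (filter ≢v₀? xs)
               (λ u (Ru , u≢v₀) → ∈-filter⁺ ≢v₀? (R⊆xs u Ru) u≢v₀) (smaller shorter)
    ...       | S , steps = S , next v₀ w₀ leaf best steps

    find-stable-exists : WellFormed G → IsSpanningTree G Sin → ∃[ S ] FindStableOutput G Tin Sin S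
    find-stable-exists wf Sin-spanning =
      run-exists wf (invariant-init Sin-spanning) Out? (allFin n) (λ u _ → ∈-allFin u) (<-wellFounded _)

    skeleton-stable : IsSpanningTree G Sin → StronglyStable G Sin 𝕆 → IsSkeleton G Sin Tin 𝕆 →
                      Invariant S R → StableOutside S (𝕆 ∩ InTree G Tin) (𝕆 ∪ Out)
    skeleton-stable {Sin = Sin} {𝕆 = 𝕆} {S = S} Sin-spanning Sin-stable skeleton inv
                    v w (o , v∈) e u arc u≢w u∉ =
      -- 𝕆 need not be decidable, so the 𝕆-component of v exists only up to double negation
      decidable-stable (rank v w <? rank v u)
        (¬¬-map via-component (¬¬-component root-orphan (reaches v) o))
      where
      Sin-arborescence : Arborescence Sin
      Sin-arborescence = spanning⇒arborescence Sin-spanning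
      open Arborescence Sin-arborescence

      Tin-v : Tin v ≡ just w
      Tin-v = trans (sym (agrees-Tin inv v v∈)) e

      via-component : ∃[ ρ ] IsCompRoot G Sin 𝕆 ρ × InSub G Sin 𝕆 ρ v → Prefers v w u
      via-component (ρ , ρ-root , v∈ρ) with skeleton ρ ρ-root
      ... | inj₂ disjoint = contradiction v∈ (disjoint v v∈ρ)
      ... | inj₁ Sin⊆Tin  =
        Sin-stable v w o Sin-v u arc u≢w (u∉ ∘ InSub-mono (λ _ → inj₁) ∘ InSub-transport Sin⊆S)
        where
        Sin⊆S : OutArcsIn G Sin (InSub G Sin 𝕆 v) S
        Sin⊆S x y x∈ e′ = trans (agrees-Tin inv x (inj₂ (y , Tin-x))) Tin-x
          where
          Tin-x : Tin x ≡ just y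
          Tin-x = Sin⊆Tin x y (InSub-trans v∈ρ x∈) e′

        Sin-v : Sin v ≡ just w
        Sin-v with ≢root⇒parent Sin-arborescence
                     (parent⇒≢root S (Arborescence.root-orphan (arborescence inv)) e)
        ... | y , e-Sin = trans e-Sin (trans (sym (Sin⊆Tin v y v∈ρ e-Sin)) Tin-v)

    settled-stable : Invariant S R → (∀ u → ¬ R u) → StableOutside S Out (𝕆 ∪ Out)
    settled-stable inv settled = StableOutside-mono (λ _ → inj₂)
      λ v w o → processed-stable inv v w (o , settled v)

    output-strongly-stable : IsSpanningTree G Sin → StronglyStable G Sin 𝕆 → IsSkeleton G Sin Tin 𝕆 →
                             Invariant S R → (∀ u → ¬ R u) → StronglyStable G S (𝕆 ∪ Out)
    output-strongly-stable Sin-spanning Sin-stable skeleton inv settled v w (inj₂ o) =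
      settled-stable inv settled v w o
    output-strongly-stable Sin-spanning Sin-stable skeleton inv settled v w (inj₁ o) with InTree? Tin v
    ... | yes v∈Tin = skeleton-stable Sin-spanning Sin-stable skeleton inv v w (o , v∈Tin)
    ... | no v∉Tin  = settled-stable inv settled v w v∉Tin

lemma6 : ∀ {n} (G : Instance n) → WellFormed G →
    ∀ (Tin Sin : Par n) (𝕆 : Subset n) →
    IsTree G Tin → IsSpanningTree G Sin →
    StronglyStable G Sin 𝕆 → IsSkeleton G Sin Tin 𝕆 →
    (∃[ S ] FindStableOutput G Tin Sin S)
    × (∀ S → FindStableOutput G Tin Sin S →
    IsSpanningTree G S × StronglyStable G S (𝕆 ∪ Outside G Tin))
lemma6 G wf Tin Sin 𝕆 Tin-tree Sin-spanning Sin-stable skeleton =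
  find-stable-exists wf Sin-spanning , output-correct
  where
  open FindStable G Tin Tin-tree

  output-correct : ∀ S → FindStableOutput G Tin Sin S →
                   IsSpanningTree G S × StronglyStable G S (𝕆 ∪ Outside G Tin)
  output-correct S output with run-invariant (invariant-init Sin-spanning) output
  ... | _ , inv , settled =
    arborescence⇒spanning G (Invariant.arborescence inv) ,
    output-strongly-stable Sin-spanning Sin-stable skeleton inv settled
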